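{- Every bipartite permutation graph is a double-threshold graph.
   Context: A graph $G=(V,E)$ is a double-threshold graph if there exist $\mathtt{w}\colon V\to\mathbb{R}$ and $\mathtt{lb},\mathtt{ub}\in\mathbb{R}$ such that for all distinct $u,v\in V$: $uv\in E$ iff $\mathtt{lb}\le\mathtt{w}(u)+\mathtt{w}(v)\le\mathtt{ub}$. A graph $G=(V,E)$ is a permutation graph if there exist linear orderings $\prec_1,\prec_2$ on $V$ such that for distinct $u,v$: $uv\in E$ iff ($u\prec_1 v$ and $v\prec_2 u$) or ($u\prec_2 v$ and $v\prec_1 u$). A bipartite permutation graph is a graph that is both bipartite and a permutation graph. -}

module Defs where

open import Level using (0ℓ)
open import Data.Nat using (ℕ)
open import Data.Fin using (Fin)
open import Data.Bool using (Bool)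
open import Data.Product using (Σ; ∃; _×_; _,_)
open import Data.Sum using (_⊎_)
open import Data.Rational using (ℚ; _≤_; _+_)
open import Relation.Binary.PropositionalEquality using (_≡_; _≢_)
open import Relation.Binary.Structures using (IsStrictTotalOrder)
open import Function.Bundles using (_⇔_)

-- A finite (simple) graph: vertex set Fin n, symmetric adjacency relation.
-- Loops are irrelevant: all notions below only quantify over distinct u, v.
record Graph : Set₁ where
  field
    n   : ℕ
    Adj : Fin n → Fin n → Set
    sym : ∀ {u v} → Adj u v → Adj v u

open Graph public

LinearOrder : ℕ → Set₁
LinearOrder n = Σ (Fin n → Fin n → Set) λ _≺_ → IsStrictTotalOrder _≡_ _≺_

IsDoubleThreshold : Graph → Set
IsDoubleThreshold G =
  Σ (Fin (n G) → ℚ) λ w → Σ ℚ λ lb → Σ ℚ λ ub →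
    ∀ (u v : Fin (n G)) → u ≢ v →
      (Adj G u v ⇔ ((lb ≤ w u + w v) × (w u + w v ≤ ub)))

IsPermutationGraph : Graph → Set₁
IsPermutationGraph G =
  Σ (LinearOrder (n G)) λ { (_≺₁_ , _) →
  Σ (LinearOrder (n G)) λ { (_≺₂_ , _) →
    ∀ (u v : Fin (n G)) → u ≢ v →
      (Adj G u v ⇔ (((u ≺₁ v) × (v ≺₂ u)) ⊎ ((u ≺₂ v) × (v ≺₁ u)))) } }

IsBipartite : Graph → Set
IsBipartite G =
  Σ (Fin (n G) → Bool) λ c → ∀ (u v : Fin (n G)) → Adj G u v → c u ≢ c v

IsBipartitePermutationGraph : Graph → Set₁
IsBipartitePermutationGraph G = IsBipartite G × IsPermutationGraph G

-- The edges are the inversions of the two orders. Two inversions u ⇝ v ⇝ w in a row would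
-- give a triangle, so in a bipartite graph every vertex is either the ≺₁-smaller end of all
-- its inversions (a source) or of none. Going up ≺₁, place each vertex v at a rational pos v
-- strictly between finitely many bounds coming from the vertices already placed, so that pos
-- is ≺₁-increasing and, for a source x and a non-source y, pos y < pos x + 1 exactly when
-- y ≺₂ x. Then x and y cross iff pos x ≤ pos y ≤ pos x + 1, i.e. iff -pos x + pos y lies in
-- [0, 1]; weights -pos on sources and pos on non-sources, with thresholds 0 and 1, do it.

module Submission where

open import Defs hiding (sym)

open import Level using (0ℓ)
open import Algebra.Properties.Group using (\\-leftDividesˡ; \\-leftDividesʳ)
open import Data.Bool.Properties using (¬-not)
open import Data.Empty using (⊥-elim)
open import Data.Fin using (Fin)
open import Data.Fin.Induction using (spo-wellFounded)
open import Data.Fin.Properties using (any?; all?)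
open import Data.List using (List; _∷_; _++_; map; filter; allFin)
open import Data.List.Membership.Propositional using (_∈_)
open import Data.List.Membership.Propositional.Properties
  using (∈-allFin; ∈-map∘filter⁺; ∈-map∘filter⁻; ∈-++⁺ˡ; ∈-++⁺ʳ; ∈-++⁻)
open import Data.List.Properties using (map-cong-local)
open import Data.List.Relation.Unary.All as All using (All)
open import Data.List.Relation.Unary.All.Properties using (all-filter)
open import Data.List.Relation.Unary.Any using (here; there)
open import Data.Nat using (ℕ)
open import Data.Product using (∃; _×_; _,_; proj₁; proj₂)
open import Data.Rational using (ℚ; 0ℚ; 1ℚ; _+_; _-_; -_; _<_; _≤_; _<?_)
open import Data.Rational.Properties
open import Data.Sum using (_⊎_; inj₁; inj₂; [_,_]′)
open import Function.Base using (id; _∘_)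
open import Function.Bundles using (_⇔_; mk⇔; Equivalence)
import Function.Properties.Equivalence as ⇔
open import Induction.WellFounded using (WellFounded; WfRec; module All; module FixPoint)
open import Relation.Binary.Bundles using (DecTotalOrder)
open import Relation.Binary.Core using (Rel)
open import Relation.Binary.Definitions using (Transitive; tri<; tri≈; tri>)
open import Relation.Binary.PropositionalEquality
  using (_≡_; _≢_; refl; sym; trans; cong; cong₂; subst; ≢-sym)
open import Relation.Binary.Structures using (IsStrictTotalOrder)
open import Relation.Nullary using (Dec; yes; no; ¬_)
open import Relation.Nullary.Decidable using (¬?; _×-dec_; _⊎-dec_; _→-dec_)
open import Relation.Unary using (Pred; Decidable)

open import Data.List.Extrema (DecTotalOrder.totalOrder ≤-decTotalOrder)
  using (max; min; xs≤max; min≤xs; argmax-all; argmin-all)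

<⇒≱ : ∀ {p q} → p < q → ¬ q ≤ p
<⇒≱ p<q q≤p = <-irrefl refl (<-≤-trans p<q q≤p)

p<p+1 : ∀ p → p < p + 1ℚ
p<p+1 p = subst (_< p + 1ℚ) (+-identityʳ p) (+-monoʳ-< p (positive⁻¹ 1ℚ))

p-1<p : ∀ p → p - 1ℚ < p
p-1<p p = subst (p - 1ℚ <_) (+-identityʳ p) (+-monoʳ-< p (negative⁻¹ (- 1ℚ)))

r≤-p+q⇔p+r≤q : ∀ p q r → r ≤ - p + q ⇔ p + r ≤ q
r≤-p+q⇔p+r≤q p q r = mk⇔
  (λ r≤ → subst (p + r ≤_) (\\-leftDividesˡ +-0-group p q) (+-monoʳ-≤ p r≤))
  (λ ≤q → subst (_≤ - p + q) (\\-leftDividesʳ +-0-group p r) (+-monoʳ-≤ (- p) ≤q))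

-p+q≤r⇔q≤p+r : ∀ p q r → - p + q ≤ r ⇔ q ≤ p + r
-p+q≤r⇔q≤p+r p q r = mk⇔
  (λ ≤r → subst (_≤ p + r) (\\-leftDividesˡ +-0-group p q) (+-monoʳ-≤ p ≤r))
  (λ q≤ → subst (- p + q ≤_) (\\-leftDividesʳ +-0-group p r) (+-monoʳ-≤ (- p) q≤))

-p+q∈[0,1]⇔ : ∀ p q → (0ℚ ≤ - p + q × - p + q ≤ 1ℚ) ⇔ (p ≤ q × q ≤ p + 1ℚ)
-p+q∈[0,1]⇔ p q = mk⇔
  (λ (lb , ub) → subst (_≤ q) (+-identityʳ p) (Equivalence.to (r≤-p+q⇔p+r≤q p q 0ℚ) lb)
               , Equivalence.to (-p+q≤r⇔q≤p+r p q 1ℚ) ub)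
  (λ (p≤q , q≤) → Equivalence.from (r≤-p+q⇔p+r≤q p q 0ℚ) (subst (_≤ q) (sym (+-identityʳ p)) p≤q)
                , Equivalence.from (-p+q≤r⇔q≤p+r p q 1ℚ) q≤)

opaque
  between : ℚ → ℚ → ℚ
  between p q with p <? q
  ... | yes p<q = proj₁ (<-dense p<q)
  ... | no _    = p

  between-spec : ∀ {p q} → p < q → p < between p q × between p q < q
  between-spec {p} {q} p<q with p <? q
  ... | yes p<q′ = proj₂ (<-dense p<q′)
  ... | no p≮q   = ⊥-elim (p≮q p<q)

  private
    ceiling : List ℚ → List ℚ → ℚ
    ceiling lo hi = min (max 0ℚ lo + 1ℚ) hi

  separator : List ℚ → List ℚ → ℚ
  separator lo hi = between (max (ceiling lo hi - 1ℚ) lo) (ceiling lo hi)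

  separator-spec : ∀ lo hi → (∀ {x y} → x ∈ lo → y ∈ hi → x < y) →
    (∀ {x} → x ∈ lo → x < separator lo hi) × (∀ {y} → y ∈ hi → separator lo hi < y)
  separator-spec lo hi lo<hi =
    (λ x∈lo → ≤-<-trans (All.lookup (xs≤max _ lo) x∈lo) (proj₁ (between-spec floor<ceiling))) ,
    (λ y∈hi → <-≤-trans (proj₂ (between-spec floor<ceiling)) (All.lookup (min≤xs _ hi) y∈hi))
    where
    lo<ceiling : All (_< ceiling lo hi) lo
    lo<ceiling = All.tabulate λ {x} x∈lo → argmin-all id {P = x <_}
      (≤-<-trans (All.lookup (xs≤max 0ℚ lo) x∈lo) (p<p+1 _)) (All.tabulate (lo<hi x∈lo))
    floor<ceiling : max (ceiling lo hi - 1ℚ) lo < ceiling lo hi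
    floor<ceiling = argmax-all id {P = _< ceiling lo hi} (p-1<p (ceiling lo hi)) lo<ceiling

module _ {a} {A : Set a} {m} {Q : Pred (Fin m) 0ℓ} (Q? : Decidable Q) where

  image : (Fin m → A) → List A
  image f = map f (filter Q? (allFin m))

  ∈-image⁺ : ∀ f {u} → Q u → f u ∈ image f
  ∈-image⁺ f {u} Qu = ∈-map∘filter⁺ f Q? (u , ∈-allFin u , refl , Qu)

  ∈-image⁻ : ∀ f {y} → y ∈ image f → ∃ λ u → Q u × y ≡ f u
  ∈-image⁻ f y∈ with ∈-map∘filter⁻ f Q? {xs = allFin m} y∈
  ... | u , _ , y≡fu , Qu = u , Qu , y≡fu

  image-cong : ∀ {f g} → (∀ {u} → Q u → f u ≡ g u) → image f ≡ image g
  image-cong f≐g = map-cong-local (All.map f≐g (all-filter Q? (allFin m)))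

module Inversions {m : ℕ} {_≺₁_ _≺₂_ : Rel (Fin m) 0ℓ}
  (≺₁-sto : IsStrictTotalOrder _≡_ _≺₁_) (≺₂-sto : IsStrictTotalOrder _≡_ _≺₂_) where

  private
    module ≺₁ = IsStrictTotalOrder ≺₁-sto
    module ≺₂ = IsStrictTotalOrder ≺₂-sto

  Inverted : Rel (Fin m) 0ℓ
  Inverted u v = u ≺₁ v × v ≺₂ u

  Crossing : Rel (Fin m) 0ℓ
  Crossing u v = Inverted u v ⊎ (u ≺₂ v × v ≺₁ u)

  inverted-trans : Transitive Inverted
  inverted-trans (u≺v , v≺u) (v≺w , w≺v) = ≺₁.trans u≺v v≺w , ≺₂.trans w≺v v≺u

  crossing-sym : ∀ {u v} → Crossing u v → Crossing v u
  crossing-sym (inj₁ (u≺v , v≺u)) = inj₂ (v≺u , u≺v)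
  crossing-sym (inj₂ (u≺v , v≺u)) = inj₁ (v≺u , u≺v)

  inverted⇒≢ : ∀ {u v} → Inverted u v → u ≢ v
  inverted⇒≢ (u≺v , _) u≡v = ≺₁.irrefl u≡v u≺v

  Unchained : Set
  Unchained = ∀ {u v w} → Inverted u v → ¬ Inverted v w

  Source : Pred (Fin m) 0ℓ
  Source u = ∃ (Inverted u)

  source? : Decidable Source
  source? u = any? λ v → (u ≺₁.<? v) ×-dec (v ≺₂.<? u)

module _ (G : Graph) {_≺₁_ _≺₂_ : Rel (Fin (n G)) 0ℓ}
  (≺₁-sto : IsStrictTotalOrder _≡_ _≺₁_) (≺₂-sto : IsStrictTotalOrder _≡_ _≺₂_) where

  open Inversions ≺₁-sto ≺₂-sto

  bipartite⇒unchained : (∀ u v → u ≢ v → Adj G u v ⇔ Crossing u v) → IsBipartite G → Unchained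
  bipartite⇒unchained adj⇔crossing (colour , proper) u⇝v v⇝w =
    proper _ _ (adjacent (inverted-trans u⇝v v⇝w))
      (trans (¬-not (proper _ _ (adjacent u⇝v))) (sym (¬-not (≢-sym (proper _ _ (adjacent v⇝w))))))
    where
    adjacent : ∀ {x y} → Inverted x y → Adj G x y
    adjacent x⇝y = Equivalence.from (adj⇔crossing _ _ (inverted⇒≢ x⇝y)) (inj₁ x⇝y)

module Representation {m : ℕ} {_≺₁_ _≺₂_ : Rel (Fin m) 0ℓ}
  (≺₁-sto : IsStrictTotalOrder _≡_ _≺₁_) (≺₂-sto : IsStrictTotalOrder _≡_ _≺₂_)
  (unchained : Inversions.Unchained ≺₁-sto ≺₂-sto) where

  open Inversions ≺₁-sto ≺₂-sto

  private
    module ≺₁ = IsStrictTotalOrder ≺₁-sto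
    module ≺₂ = IsStrictTotalOrder ≺₂-sto

  inverted⇒¬source : ∀ {u v} → Inverted u v → ¬ Source v
  inverted⇒¬source u⇝v (_ , v⇝w) = unchained u⇝v v⇝w

  crossing-endpoints : ∀ {u v} → Crossing u v → Source u × ¬ Source v ⊎ ¬ Source u × Source v
  crossing-endpoints (inj₁ u⇝v) = inj₁ ((_ , u⇝v) , inverted⇒¬source u⇝v)
  crossing-endpoints (inj₂ (u≺₂v , v≺₁u)) =
    inj₂ (inverted⇒¬source (v≺₁u , u≺₂v) , (_ , v≺₁u , u≺₂v))

  -- Close v w fails iff some non-source x ≺₁ v lies ≺₂-above w; then no later non-source can
  -- lie ≺₂-below w. Otherwise such a later y would need pos v < pos y < pos w + 1, so pos v
  -- must already stay below pos w + 1.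
  Close : Rel (Fin m) 0ℓ
  Close v w = ∀ x → x ≺₁ v → w ≺₂ x → Source x

  close? : ∀ v w → Dec (Close v w)
  close? v w = all? λ x → (x ≺₁.<? v) →-dec (w ≺₂.<? x) →-dec source? x

  LowerShift UpperShift : Fin m → Pred (Fin m) 0ℓ
  LowerShift v u = u ≺₁ v × u ≺₂ v × Source u × ¬ Source v
  UpperShift v u = u ≺₁ v × (Source v × Source u × Close v u ⊎ ¬ Source v × v ≺₂ u)

  lowerShift? : ∀ v → Decidable (LowerShift v)
  lowerShift? v u = (u ≺₁.<? v) ×-dec (u ≺₂.<? v) ×-dec source? u ×-dec ¬? (source? v)

  upperShift? : ∀ v → Decidable (UpperShift v)
  upperShift? v u = (u ≺₁.<? v) ×-dec
    ((source? v ×-dec source? u ×-dec close? v u) ⊎-dec (¬? (source? v) ×-dec (v ≺₂.<? u)))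

  below? : ∀ v → Decidable (_≺₁ v)
  below? v u = u ≺₁.<? v

  -- The bound 1 keeps the sum of two weights of the same sign outside [0, 1].
  lowerBounds upperBounds : (Fin m → ℚ) → Fin m → List ℚ
  lowerBounds f v = 1ℚ ∷ image (below? v) f ++ image (lowerShift? v) (λ u → f u + 1ℚ)
  upperBounds f v = image (upperShift? v) (λ u → f u + 1ℚ)

  ∈-lowerBounds-≺₁ : ∀ f {u v} → u ≺₁ v → f u ∈ lowerBounds f v
  ∈-lowerBounds-≺₁ f u≺v = there (∈-++⁺ˡ (∈-image⁺ _ f u≺v))

  ∈-lowerBounds-shift : ∀ f {u v} → LowerShift v u → f u + 1ℚ ∈ lowerBounds f v
  ∈-lowerBounds-shift f {v = v} shift =
    there (∈-++⁺ʳ (image (below? v) f) (∈-image⁺ _ (λ u → f u + 1ℚ) shift))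

  ∈-upperBounds-shift : ∀ f {u v} → UpperShift v u → f u + 1ℚ ∈ upperBounds f v
  ∈-upperBounds-shift f shift = ∈-image⁺ _ (λ u → f u + 1ℚ) shift

  ∈-lowerBounds⁻ : ∀ f {v x} → x ∈ lowerBounds f v →
    x ≡ 1ℚ ⊎ (∃ λ u → u ≺₁ v × x ≡ f u) ⊎ (∃ λ u → LowerShift v u × x ≡ f u + 1ℚ)
  ∈-lowerBounds⁻ f (here x≡1) = inj₁ x≡1
  ∈-lowerBounds⁻ f {v} (there x∈) with ∈-++⁻ (image (below? v) f) x∈
  ... | inj₁ x∈≺₁ = inj₂ (inj₁ (∈-image⁻ _ f x∈≺₁))
  ... | inj₂ x∈shift = inj₂ (inj₂ (∈-image⁻ _ _ x∈shift))

  place : (Fin m → ℚ) → Fin m → ℚ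
  place f v = separator (lowerBounds f v) (upperBounds f v)

  place-cong : ∀ {f g} v → (∀ {u} → u ≺₁ v → f u ≡ g u) → place f v ≡ place g v
  place-cong {f} {g} v f≐g = cong₂ separator
    (cong (1ℚ ∷_) (cong₂ _++_ (image-cong (below? v) f≐g)
                                (image-cong (lowerShift? v) (shifted ∘ proj₁))))
    (image-cong (upperShift? v) (shifted ∘ proj₁))
    where
    shifted : ∀ {u} → u ≺₁ v → f u + 1ℚ ≡ g u + 1ℚ
    shifted u≺v = cong (_+ 1ℚ) (f≐g u≺v)

  -- wfRec supplies only the values below v, which are all that place looks at.
  extend : ∀ {v} → WfRec _≺₁_ (λ _ → ℚ) v → Fin m → ℚ
  extend {v} rec u with u ≺₁.<? v
  ... | yes u≺v = rec u≺v
  ... | no _    = 0ℚ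

  extend-restriction : ∀ (f : Fin m → ℚ) {u v} → u ≺₁ v → extend {v} (λ {w} _ → f w) u ≡ f u
  extend-restriction f {u} {v} u≺v with u ≺₁.<? v
  ... | yes _   = refl
  ... | no u⊀v = ⊥-elim (u⊀v u≺v)

  ≺₁-wellFounded : WellFounded _≺₁_
  ≺₁-wellFounded = spo-wellFounded ≺₁.isStrictPartialOrder

  private
    placeAbove : ∀ v → WfRec _≺₁_ (λ _ → ℚ) v → ℚ
    placeAbove v rec = place (extend rec) v

    placeAbove-cong : ∀ v {rec rec′ : WfRec _≺₁_ (λ _ → ℚ) v} →
      (∀ {u} (u≺v : u ≺₁ v) → rec u≺v ≡ rec′ u≺v) → placeAbove v rec ≡ placeAbove v rec′
    placeAbove-cong v {rec} {rec′} rec≐rec′ = place-cong v λ {u} _ → extend-cong u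
      where
      extend-cong : ∀ u → extend rec u ≡ extend rec′ u
      extend-cong u with u ≺₁.<? v
      ... | yes u≺v = rec≐rec′ u≺v
      ... | no _    = refl

  opaque
    pos : Fin m → ℚ
    pos = All.wfRec ≺₁-wellFounded 0ℓ (λ _ → ℚ) placeAbove

    pos-fixpoint : ∀ v → pos v ≡ place pos v
    pos-fixpoint v = trans unfold-wfRec (place-cong v (extend-restriction pos))
      where open FixPoint ≺₁-wellFounded (λ _ → ℚ) placeAbove placeAbove-cong using (unfold-wfRec)

  Placed : Pred (Fin m) 0ℓ
  Placed v = (∀ {x} → x ∈ lowerBounds pos v → x < pos v)
           × (∀ {y} → y ∈ upperBounds pos v → pos v < y)

  upperShift⇒close : ∀ {v w} → UpperShift v w → Source w × Close v w
  upperShift⇒close (_ , inj₁ (_ , w-source , w-close)) = w-source , w-close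
  upperShift⇒close (w≺v , inj₂ (_ , v≺₂w)) =
    (_ , w≺v , v≺₂w) , λ x x≺v w≺₂x → _ , x≺v , ≺₂.trans v≺₂w w≺₂x

  module _ {v} (placed-below : ∀ {u} → u ≺₁ v → Placed u) where

    pos-mono-below : ∀ {u w} → w ≺₁ v → u ≺₁ w → pos u < pos w
    pos-mono-below w≺v u≺w = proj₁ (placed-below w≺v) (∈-lowerBounds-≺₁ pos u≺w)

    close⇒pos<pos+1 : ∀ {u w} → u ≺₁ v → w ≺₁ v → Source w → Close v w → pos u < pos w + 1ℚ
    close⇒pos<pos+1 {u} {w} u≺v w≺v w-source w-close with ≺₁.compare u w
    ... | tri< u≺w _ _ = <-trans (pos-mono-below w≺v u≺w) (p<p+1 (pos w))
    ... | tri≈ _ refl _ = p<p+1 (pos w)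
    ... | tri> _ _ w≺u = proj₂ (placed-below u≺v) (∈-upperBounds-shift pos (w≺u , shift))
      where
      shift : Source u × Source w × Close u w ⊎ ¬ Source u × u ≺₂ w
      shift with source? u | ≺₂.compare u w
      ... | yes u-source | _ = inj₁ (u-source , w-source , λ x x≺u → w-close x (≺₁.trans x≺u u≺v))
      ... | no u-sink | tri< u≺₂w _ _ = inj₂ (u-sink , u≺₂w)
      ... | no _      | tri≈ _ refl _ = ⊥-elim (≺₁.irrefl refl w≺u)
      ... | no u-sink | tri> _ _ w≺₂u = ⊥-elim (u-sink (w-close u u≺v w≺₂u))

    lowerShift⇒pos< : ∀ {u w} → LowerShift v u → w ≺₁ v → v ≺₂ w → pos u < pos w
    lowerShift⇒pos< {u} {w} (_ , u≺₂v , u-source , _) w≺v v≺₂w with ≺₁.compare u w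
    ... | tri< u≺w _ _ = pos-mono-below w≺v u≺w
    ... | tri≈ _ refl _ = ⊥-elim (≺₂.irrefl refl (≺₂.trans u≺₂v v≺₂w))
    ... | tri> _ _ w≺u = ⊥-elim (inverted⇒¬source (w≺u , ≺₂.trans u≺₂v v≺₂w) u-source)

    lowerBounds<upperBounds : ∀ {x y} → x ∈ lowerBounds pos v → y ∈ upperBounds pos v → x < y
    lowerBounds<upperBounds x∈ y∈ with ∈-lowerBounds⁻ pos x∈ | ∈-image⁻ _ _ y∈
    ... | inj₁ refl | w , (w≺v , _) , refl =
      <-trans (proj₁ (placed-below w≺v) (here refl)) (p<p+1 (pos w))
    ... | inj₂ (inj₁ (u , u≺v , refl)) | w , shift@(w≺v , _) , refl =
      let w-source , w-close = upperShift⇒close shift in close⇒pos<pos+1 u≺v w≺v w-source w-close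
    ... | inj₂ (inj₂ (u , (_ , _ , _ , v-sink) , refl)) | w , (_ , inj₁ (v-source , _)) , refl =
      ⊥-elim (v-sink v-source)
    ... | inj₂ (inj₂ (u , shift , refl)) | w , (w≺v , inj₂ (_ , v≺₂w)) , refl =
      +-monoˡ-< 1ℚ (lowerShift⇒pos< shift w≺v v≺₂w)

  placed : ∀ v → Placed v
  placed = All.wfRec ≺₁-wellFounded 0ℓ Placed λ v placed-below →
    let below , above = separator-spec (lowerBounds pos v) (upperBounds pos v)
                                       (lowerBounds<upperBounds placed-below)
    in subst (_ <_) (sym (pos-fixpoint v)) ∘ below , subst (_< _) (sym (pos-fixpoint v)) ∘ above

  1<pos : ∀ v → 1ℚ < pos v
  1<pos v = proj₁ (placed v) (here refl)

  0<pos : ∀ v → 0ℚ < pos v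
  0<pos v = <-trans (positive⁻¹ 1ℚ) (1<pos v)

  pos-mono : ∀ {u v} → u ≺₁ v → pos u < pos v
  pos-mono {v = v} u≺v = proj₁ (placed v) (∈-lowerBounds-≺₁ pos u≺v)

  pos<pos+1 : ∀ {x y} → Source x → ¬ Source y → y ≺₂ x → pos y < pos x + 1ℚ
  pos<pos+1 {x} {y} x-source y-sink y≺₂x with ≺₁.compare x y
  ... | tri< x≺y _ _ = proj₂ (placed y) (∈-upperBounds-shift pos (x≺y , inj₂ (y-sink , y≺₂x)))
  ... | tri≈ _ refl _ = ⊥-elim (y-sink x-source)
  ... | tri> _ _ y≺x = <-trans (pos-mono y≺x) (p<p+1 (pos x))

  pos+1<pos : ∀ {x y} → Source x → ¬ Source y → x ≺₂ y → pos x + 1ℚ < pos y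
  pos+1<pos {x} {y} x-source y-sink x≺₂y with ≺₁.compare x y
  ... | tri< x≺y _ _ = proj₁ (placed y) (∈-lowerBounds-shift pos (x≺y , x≺₂y , x-source , y-sink))
  ... | tri≈ _ refl _ = ⊥-elim (y-sink x-source)
  ... | tri> _ _ y≺x = ⊥-elim (y-sink (_ , y≺x , x≺₂y))

  crossing⇔pos-window : ∀ {x y} → Source x → ¬ Source y →
    Crossing x y ⇔ (pos x ≤ pos y × pos y ≤ pos x + 1ℚ)
  crossing⇔pos-window {x} {y} x-source y-sink = mk⇔ to from
    where
    to : Crossing x y → pos x ≤ pos y × pos y ≤ pos x + 1ℚ
    to (inj₁ (x≺y , y≺₂x)) = <⇒≤ (pos-mono x≺y) , <⇒≤ (pos<pos+1 x-source y-sink y≺₂x)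
    to (inj₂ (x≺₂y , y≺x)) = ⊥-elim (y-sink (_ , y≺x , x≺₂y))
    from : pos x ≤ pos y × pos y ≤ pos x + 1ℚ → Crossing x y
    from (x≤y , y≤x+1) with ≺₁.compare x y | ≺₂.compare x y
    ... | tri> _ _ y≺x | _ = ⊥-elim (<⇒≱ (pos-mono y≺x) x≤y)
    ... | tri≈ _ refl _ | _ = ⊥-elim (y-sink x-source)
    ... | tri< x≺y _ _ | tri> _ _ y≺₂x = inj₁ (x≺y , y≺₂x)
    ... | tri< _ _ _ | tri≈ _ refl _ = ⊥-elim (y-sink x-source)
    ... | tri< _ _ _ | tri< x≺₂y _ _ = ⊥-elim (<⇒≱ (pos+1<pos x-source y-sink x≺₂y) y≤x+1)

  weight : Fin m → ℚ
  weight v with source? v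
  ... | yes _ = - pos v
  ... | no _  = pos v

  crossing⇔threshold : ∀ u v →
    Crossing u v ⇔ (0ℚ ≤ weight u + weight v × weight u + weight v ≤ 1ℚ)
  crossing⇔threshold u v with source? u | source? v
  ... | yes u-source | yes v-source = mk⇔
    (λ c → ⊥-elim ([ (λ (_ , v-sink) → v-sink v-source) , (λ (u-sink , _) → u-sink u-source) ]′
                     (crossing-endpoints c)))
    (λ (0≤ , _) → ⊥-elim (<⇒≱ (+-mono-< (neg-antimono-< (0<pos u)) (neg-antimono-< (0<pos v))) 0≤))
  ... | no u-sink | no v-sink = mk⇔
    (λ c → ⊥-elim ([ (λ (u-source , _) → u-sink u-source) , (λ (_ , v-source) → v-sink v-source) ]′
                     (crossing-endpoints c)))
    (λ (_ , ≤1) → ⊥-elim (<⇒≱ (+-mono-< (1<pos u) (0<pos v)) ≤1))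
  ... | yes u-source | no v-sink =
    ⇔.trans (crossing⇔pos-window u-source v-sink) (⇔.sym (-p+q∈[0,1]⇔ (pos u) (pos v)))
  ... | no u-sink | yes v-source rewrite +-comm (pos u) (- pos v) =
    ⇔.trans (mk⇔ crossing-sym crossing-sym)
      (⇔.trans (crossing⇔pos-window v-source u-sink) (⇔.sym (-p+q∈[0,1]⇔ (pos v) (pos u))))

lemma3p2 : (G : Graph) → IsBipartitePermutationGraph G → IsDoubleThreshold G
lemma3p2 G (bipartite , (_≺₁_ , ≺₁-sto) , (_≺₂_ , ≺₂-sto) , adj⇔crossing) =
  weight , 0ℚ , 1ℚ , λ u v u≢v → ⇔.trans (adj⇔crossing u v u≢v) (crossing⇔threshold u v)
  where
  open Representation ≺₁-sto ≺₂-sto (bipartite⇒unchained G ≺₁-sto ≺₂-sto adj⇔crossing bipartite)
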